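{- Let $G=(V,E)$ be an acyclic transitive directed graph and let $S=(V,E_S)$ with $E_S\subseteq E$ be a subgraph of $G$. Then $S$ is a maximal (with respect to inclusion of edge sets) 2-dimensional subgraph of $G$ if and only if its undirected closure $\mathcal{U}(S)$ is a maximal (with respect to inclusion of edge sets) permutation subgraph of $\mathcal{U}(G)$.
   Context: All graphs are simple and directed; an undirected edge is represented as a pair of opposite directed edges, and a graph is undirected if $E=E^{ -1}$, where $E^{ -1}=\{(b,a)\mid (a,b)\in E\}$. $\mathcal{U}(G)=(V,E\cup E^{ -1})$ is the undirected closure, and the complement of $G$ is $(V,\{(a,b)\mid a,b\in V,\ a\neq b\}\setminus (E\cup E^{ -1}))$. A graph is transitive if $(a,b),(b,c)\in E$ with $a\neq c$ implies $(a,c)\in E$. A graph $(V,E)$ is oriented if $E\cap E^{ -1}=\emptyset$; $(V,E')$ is an orientation of $(V,E)$ if $E'$ is a maximal oriented subset of $E$; a graph is transitively orientable if it has an orientation that is transitive. An undirected graph is a permutation graph iff both it and its complement are transitively orientable. Subgraphs are graphs $(V,E')$ with $E'\subseteq E$. An acyclic transitive graph is viewed as a strict partial order; it is 2-dimensional if its edge relation is the intersection of at most two linear orders on $V$. -}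

module Defs where

open import Data.Nat using (ℕ)
open import Data.Fin using (Fin; _≟_)
open import Relation.Nullary.Decidable using (⌊_⌋)
open import Data.Bool using (Bool; true; false; T; _∧_; _∨_; not)
open import Data.Product using (_×_; ∃; ∃-syntax)
open import Data.Sum using (_⊎_)
open import Data.Empty using (⊥)
open import Relation.Nullary using (¬_)
open import Relation.Binary.PropositionalEquality using (_≡_; _≢_)

-- A directed graph on the finite vertex set V = Fin n is given by its
-- (decidable) edge relation.  (a , b) ∈ E  iff  T (E a b).
Edges : ℕ → Set
Edges n = Fin n → Fin n → Bool

module _ {n : ℕ} where

  _∈E_ : Fin n → Fin n → Edges n → Set
  _∈E_ a b E = T (E a b)

  Simple : Edges n → Set
  Simple E = ∀ a → ¬ T (E a a)

  _⊆E_ : Edges n → Edges n → Set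
  E ⊆E F = ∀ a b → T (E a b) → T (F a b)

  inv : Edges n → Edges n
  inv E a b = E b a

  𝒰 : Edges n → Edges n
  𝒰 E a b = E a b ∨ E b a

  Undirected : Edges n → Set
  Undirected E = ∀ a b → T (E a b) → T (E b a)

  complement : Edges n → Edges n
  complement E a b = not ⌊ a ≟ b ⌋ ∧ not (E a b ∨ E b a)

  Transitive : Edges n → Set
  Transitive E = ∀ a b c → T (E a b) → T (E b c) → a ≢ c → T (E a c)

  data Path (E : Edges n) : Fin n → Fin n → Set where
    edge : ∀ {a b} → T (E a b) → Path E a b
    _∷ₚ_ : ∀ {a b c} → T (E a b) → Path E b c → Path E a c

  Acyclic : Edges n → Set
  Acyclic E = ∀ a → ¬ Path E a a

  Oriented : Edges n → Set
  Oriented E = ∀ a b → T (E a b) → ¬ T (E b a)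

  IsOrientation : Edges n → Edges n → Set
  IsOrientation E' E =
    E' ⊆E E × Oriented E' ×
    (∀ F → Oriented F → E' ⊆E F → F ⊆E E → F ⊆E E')

  TransitivelyOrientable : Edges n → Set
  TransitivelyOrientable E = ∃[ E' ] (IsOrientation E' E × Transitive E')

  PermutationGraph : Edges n → Set
  PermutationGraph E = Simple E × Undirected E ×
    TransitivelyOrientable E × TransitivelyOrientable (complement E)

  StrictLinearOrder : Edges n → Set
  StrictLinearOrder L = Simple L × Transitive L ×
    (∀ a b → a ≢ b → T (L a b) ⊎ T (L b a)) × Oriented L

  -- 2-dimensional: edge relation is the intersection of (at most) two linear
  -- orders on V (one order = taking the same order twice)
  TwoDimensional : Edges n → Set
  TwoDimensional E = ∃[ L₁ ] ∃[ L₂ ]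
    (StrictLinearOrder L₁ × StrictLinearOrder L₂ ×
     (∀ a b → (T (E a b) → T (L₁ a b) × T (L₂ a b)) ×
              (T (L₁ a b) × T (L₂ a b) → T (E a b))))

  MaxTwoDimSubgraph : Edges n → Edges n → Set
  MaxTwoDimSubgraph S G = (S ⊆E G × TwoDimensional S) ×
    (∀ S' → S' ⊆E G → TwoDimensional S' → S ⊆E S' → S' ⊆E S)

  MaxPermSubgraph : Edges n → Edges n → Set
  MaxPermSubgraph P H = (P ⊆E H × PermutationGraph P) ×
    (∀ P' → P' ⊆E H → PermutationGraph P' → P ⊆E P' → P' ⊆E P)

-- Both directions of the equivalence follow by a transfer argument from two
-- facts relating the two notions:
--   (A) if S is 2-dimensional, realised by linear orders L₁ and L₂, then
--       𝒰 S is a permutation graph: S orients 𝒰 S transitively and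
--       L₁ ∩ L₂⁻¹ orients its complement transitively;
--   (B) if P ⊆ 𝒰 G is a permutation graph, then the transitive closure S of
--       the G-orientation X = P ∩ G of P is a 2-dimensional subgraph of G
--       with P ⊆ 𝒰 S.
-- For (B) we take a transitive orientation C of the complement of P and
-- interleave S with C on the S-incomparable pairs; this gives two linear
-- orders (one for C, one for C⁻¹) whose intersection is S.  The key point is
-- that C-chains of S-incomparable pairs stay S-incomparable, which is proved
-- by walking along an X-path.  The transitive closure is computed by
-- Warshall's algorithm, so that it is again a Boolean edge relation.
-- Finally, since G is acyclic, a subgraph of G is determined by its
-- undirected closure, which transports maximality between the two settings.
module Submission where

open import Defs
open import Data.Nat using (ℕ)
open import Data.Fin using (Fin; _≟_)
open import Data.Bool using (true; false; T; _∧_; _∨_; not)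
open import Data.Bool.Properties using (T-∧; T-∨)
open import Data.Unit using (tt)
open import Data.Empty using (⊥-elim)
open import Data.Product using (_×_; _,_; proj₁; proj₂; ∃-syntax)
open import Data.Sum using (_⊎_; inj₁; inj₂; swap)
open import Data.List using (List; []; _∷_; allFin)
open import Data.List.Membership.Propositional using (_∈_)
open import Data.List.Membership.Propositional.Properties using (∈-allFin)
open import Data.List.Relation.Unary.Any using (here; there)
open import Function.Bundles using (Equivalence)
open import Relation.Nullary using (¬_; yes; no)
open import Relation.Nullary.Decidable using (⌊_⌋; T?; fromWitness; fromWitnessFalse)
open import Relation.Binary.PropositionalEquality using (_≡_; _≢_; refl; sym)

module _ {n : ℕ} where

  _∪_ : Edges n → Edges n → Edges n
  (E ∪ F) a b = E a b ∨ F a b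

  _∩_ : Edges n → Edges n → Edges n
  (E ∩ F) a b = E a b ∧ F a b

  ∪-elim : ∀ {E F : Edges n} {a b} → T ((E ∪ F) a b) → T (E a b) ⊎ T (F a b)
  ∪-elim {E} {F} {a} {b} = Equivalence.to (T-∨ {E a b} {F a b})

  ∪-inl : ∀ {E F : Edges n} {a b} → T (E a b) → T ((E ∪ F) a b)
  ∪-inl {E} {F} {a} {b} e = Equivalence.from (T-∨ {E a b} {F a b}) (inj₁ e)

  ∪-inr : ∀ {E F : Edges n} {a b} → T (F a b) → T ((E ∪ F) a b)
  ∪-inr {E} {F} {a} {b} f = Equivalence.from (T-∨ {E a b} {F a b}) (inj₂ f)

  ∩-elim : ∀ {E F : Edges n} {a b} → T ((E ∩ F) a b) → T (E a b) × T (F a b)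
  ∩-elim {E} {F} {a} {b} = Equivalence.to (T-∧ {E a b} {F a b})

  ∩-intro : ∀ {E F : Edges n} {a b} → T (E a b) → T (F a b) → T ((E ∩ F) a b)
  ∩-intro {E} {F} {a} {b} e f = Equivalence.from (T-∧ {E a b} {F a b}) (e , f)

  𝒰-elim : ∀ {E : Edges n} {a b} → T (𝒰 E a b) → T (E a b) ⊎ T (E b a)
  𝒰-elim {E} = ∪-elim {E} {inv E}

  𝒰-inl : ∀ {E : Edges n} {a b} → T (E a b) → T (𝒰 E a b)
  𝒰-inl {E} = ∪-inl {E} {inv E}

  𝒰-inr : ∀ {E : Edges n} {a b} → T (E b a) → T (𝒰 E a b)
  𝒰-inr {E} = ∪-inr {E} {inv E}

  𝒰-undirected : ∀ (E : Edges n) → Undirected (𝒰 E)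
  𝒰-undirected E a b u with 𝒰-elim {E} u
  ... | inj₁ ab = 𝒰-inr {E} ab
  ... | inj₂ ba = 𝒰-inl {E} ba

  ¬𝒰-sym : ∀ {E : Edges n} {a b} → ¬ T (𝒰 E a b) → ¬ T (𝒰 E b a)
  ¬𝒰-sym {E} ¬ab ba = ¬ab (𝒰-undirected E _ _ ba)

  undirected-𝒰 : ∀ {E : Edges n} → Undirected E → 𝒰 E ⊆E E
  undirected-𝒰 {E} undirected a b u with 𝒰-elim {E} u
  ... | inj₁ ab = ab
  ... | inj₂ ba = undirected b a ba

  𝒰-mono : ∀ {E F : Edges n} → E ⊆E F → 𝒰 E ⊆E 𝒰 F
  𝒰-mono {E} {F} E⊆F a b u with 𝒰-elim {E} u
  ... | inj₁ ab = 𝒰-inl {F} (E⊆F a b ab)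
  ... | inj₂ ba = 𝒰-inr {F} (E⊆F b a ba)

  𝒰-simple : ∀ {E : Edges n} → Simple E → Simple (𝒰 E)
  𝒰-simple {E} simple a u with 𝒰-elim {E} u
  ... | inj₁ aa = simple a aa
  ... | inj₂ aa = simple a aa

  ⊆-trans : ∀ {E F H : Edges n} → E ⊆E F → F ⊆E H → E ⊆E H
  ⊆-trans E⊆F F⊆H a b e = F⊆H a b (E⊆F a b e)

  T-not : ∀ {x} → ¬ T x → T (not x)
  T-not {false} _ = tt
  T-not {true} ¬x = ¬x tt

  T-not⁻¹ : ∀ {x} → T (not x) → ¬ T x
  T-not⁻¹ {false} _ ()

  -- the pairs that are not adjacent in 𝒰 R (the diagonal included)
  incomparable : Edges n → Edges n
  incomparable R a b = not (𝒰 R a b)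

  complement-intro : ∀ {E : Edges n} {a b} → a ≢ b → ¬ T (𝒰 E a b) → T (complement E a b)
  complement-intro {E} {a} {b} a≢b ¬u =
    ∩-intro {λ x y → not ⌊ x ≟ y ⌋} {incomparable E}
            (fromWitnessFalse a≢b) (T-not ¬u)

  complement-elim : ∀ {E : Edges n} {a b} → T (complement E a b) → a ≢ b × ¬ T (𝒰 E a b)
  complement-elim {E} {a} {b} c with a ≟ b
  ... | yes _ = ⊥-elim c
  ... | no a≢b = a≢b , T-not⁻¹ c

  complement-simple : ∀ (E : Edges n) → Simple (complement E)
  complement-simple E a c = proj₁ (complement-elim {E} c) refl

  oriented⇒simple : ∀ {E : Edges n} → Oriented E → Simple E
  oriented⇒simple oriented a aa = oriented a a aa aa

  strict-trans : ∀ {E : Edges n} → Transitive E → Oriented E →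
                 ∀ {a b c} → T (E a b) → T (E b c) → T (E a c)
  strict-trans transitive oriented {a} {b} {c} ab bc with a ≟ c
  ... | yes refl = ⊥-elim (oriented a b ab bc)
  ... | no a≢c = transitive a b c ab bc a≢c

  covering⇒orientation : ∀ {E' E : Edges n} → E' ⊆E E → Oriented E' →
    (∀ a b → T (E a b) → T (E' a b) ⊎ T (E' b a)) → IsOrientation E' E
  covering⇒orientation {E'} {E} E'⊆E oriented covers = E'⊆E , oriented , maximal
    where
    maximal : ∀ F → Oriented F → E' ⊆E F → F ⊆E E → F ⊆E E'
    maximal F F-oriented E'⊆F F⊆E a b f with covers a b (F⊆E a b f)
    ... | inj₁ ab = ab
    ... | inj₂ ba = ⊥-elim (F-oriented a b f (E'⊆F b a ba))

  single : Fin n → Fin n → Edges n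
  single a b x y = ⌊ x ≟ a ⌋ ∧ ⌊ y ≟ b ⌋

  single-elim : ∀ {a b} x y → T (single a b x y) → x ≡ a × y ≡ b
  single-elim {a} {b} x y s with x ≟ a | y ≟ b
  ... | yes x≡a | yes y≡b = x≡a , y≡b
  ... | yes _ | no _ = ⊥-elim s
  ... | no _ | _ = ⊥-elim s

  single-self : ∀ a b → T (single a b a b)
  single-self a b = Equivalence.from (T-∧ {⌊ a ≟ a ⌋} {⌊ b ≟ b ⌋}) (fromWitness refl , fromWitness refl)

  add-edge-oriented : ∀ {E : Edges n} {a b} → Oriented E → ¬ T (E b a) → a ≢ b →
                      Oriented (E ∪ single a b)
  add-edge-oriented {E} {a} {b} oriented ¬ba a≢b x y xy yx
    with ∪-elim {E} {single a b} xy | ∪-elim {E} {single a b} yx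
  ... | inj₁ e-xy | inj₁ e-yx = oriented x y e-xy e-yx
  ... | inj₁ e-xy | inj₂ s-yx with single-elim y x s-yx
  ...   | refl , refl = ¬ba e-xy
  add-edge-oriented {E} {a} {b} oriented ¬ba a≢b x y xy yx
      | inj₂ s-xy | inj₁ e-yx with single-elim x y s-xy
  ...   | refl , refl = ¬ba e-yx
  add-edge-oriented {E} {a} {b} oriented ¬ba a≢b x y xy yx
      | inj₂ s-xy | inj₂ s-yx with single-elim x y s-xy | single-elim y x s-yx
  ...   | refl , refl | refl , _ = a≢b refl

  orientation-covers : ∀ {E' E : Edges n} → Simple E → IsOrientation E' E →
    ∀ a b → T (E a b) → T (E' a b) ⊎ T (E' b a)
  orientation-covers {E'} {E} simple (E'⊆E , oriented , maximal) a b e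
    with T? (E' a b) | T? (E' b a)
  ... | yes ab | _ = inj₁ ab
  ... | no _ | yes ba = inj₂ ba
  ... | no ¬ab | no ¬ba =
    ⊥-elim (¬ab (maximal (E' ∪ single a b) (add-edge-oriented oriented ¬ba a≢b)
                         (λ x y → ∪-inl {E'} {single a b}) extended⊆E
                         a b (∪-inr {E'} {single a b} (single-self a b))))
    where
    a≢b : a ≢ b
    a≢b refl = simple a e
    extended⊆E : (E' ∪ single a b) ⊆E E
    extended⊆E x y xy with ∪-elim {E'} {single a b} xy
    ... | inj₁ e' = E'⊆E x y e'
    ... | inj₂ s with single-elim x y s
    ...   | refl , refl = e

  _++ₚ_ : ∀ {E : Edges n} {a b c} → Path E a b → Path E b c → Path E a c
  edge e ++ₚ q = e ∷ₚ q
  (e ∷ₚ p) ++ₚ q = e ∷ₚ (p ++ₚ q)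

  Path-mono : ∀ {E F : Edges n} {a b} → E ⊆E F → Path E a b → Path F a b
  Path-mono E⊆F (edge e) = edge (E⊆F _ _ e)
  Path-mono E⊆F (e ∷ₚ p) = E⊆F _ _ e ∷ₚ Path-mono E⊆F p

  transitive-closed : ∀ {E : Edges n} → Acyclic E → Transitive E →
                      ∀ {a b} → Path E a b → T (E a b)
  transitive-closed acyclic transitive (edge e) = e
  transitive-closed acyclic transitive {a} {c} (e ∷ₚ p) with a ≟ c
  ... | yes refl = ⊥-elim (acyclic a (e ∷ₚ p))
  ... | no a≢c = transitive a _ c e (transitive-closed acyclic transitive p) a≢c

  -- Warshall's algorithm: `warshall X vs` relates a to b iff some X-path
  -- from a to b has all its intermediate vertices in vs (for acyclic X).

  through : Edges n → Fin n → Edges n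
  through W v a b = W a v ∧ W v b

  through-elim : ∀ {W : Edges n} {v a b} → T (through W v a b) → T (W a v) × T (W v b)
  through-elim {W} {v} {a} {b} = Equivalence.to (T-∧ {W a v} {W v b})

  through-intro : ∀ {W : Edges n} {v a b} → T (W a v) → T (W v b) → T (through W v a b)
  through-intro {W} {v} {a} {b} av vb = Equivalence.from (T-∧ {W a v} {W v b}) (av , vb)

  warshall : Edges n → List (Fin n) → Edges n
  warshall X [] = X
  warshall X (v ∷ vs) = warshall X vs ∪ through (warshall X vs) v

  data PathVia (X : Edges n) (vs : List (Fin n)) : Fin n → Fin n → Set where
    edge : ∀ {a b} → T (X a b) → PathVia X vs a b
    step : ∀ {a c b} → T (X a c) → c ∈ vs → PathVia X vs c b → PathVia X vs a b

  PathVia⇒Path : ∀ {X vs a b} → PathVia X vs a b → Path X a b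
  PathVia⇒Path (edge e) = edge e
  PathVia⇒Path (step e _ p) = e ∷ₚ PathVia⇒Path p

  Path⇒PathVia : ∀ {X a b} → Path X a b → PathVia X (allFin n) a b
  Path⇒PathVia (edge e) = edge e
  Path⇒PathVia (_∷ₚ_ {b = c} e p) = step e (∈-allFin c) (Path⇒PathVia p)

  PathVia-split : ∀ {X v vs a b} → PathVia X (v ∷ vs) a b →
    PathVia X vs a b ⊎ (PathVia X vs a v × PathVia X (v ∷ vs) v b)
  PathVia-split (edge e) = inj₁ (edge e)
  PathVia-split (step e (here refl) p) = inj₂ (edge e , p)
  PathVia-split (step e (there c∈vs) p) with PathVia-split p
  ... | inj₁ q = inj₁ (step e c∈vs q)
  ... | inj₂ (q , r) = inj₂ (step e c∈vs q , r)

  warshall-sound : ∀ X vs {a b} → T (warshall X vs a b) → Path X a b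
  warshall-sound X [] e = edge e
  warshall-sound X (v ∷ vs) w with ∪-elim {warshall X vs} {through (warshall X vs) v} w
  ... | inj₁ direct = warshall-sound X vs direct
  ... | inj₂ via-v with through-elim {warshall X vs} via-v
  ...   | av , vb = warshall-sound X vs av ++ₚ warshall-sound X vs vb

  -- Completeness needs acyclicity: a path returning to v would be a cycle.
  warshall-complete : ∀ {X} → Acyclic X → ∀ vs {a b} → PathVia X vs a b → T (warshall X vs a b)
  warshall-complete acyclic [] (edge e) = e
  warshall-complete {X} acyclic (v ∷ vs) p with PathVia-split p
  ... | inj₁ q = ∪-inl {warshall X vs} {through (warshall X vs) v} (warshall-complete acyclic vs q)
  ... | inj₂ (q , r) with PathVia-split r
  ...   | inj₁ r' = ∪-inr {warshall X vs} {through (warshall X vs) v}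
                      (through-intro {warshall X vs} (warshall-complete acyclic vs q)
                                                     (warshall-complete acyclic vs r'))
  ...   | inj₂ (cycle , _) = ⊥-elim (acyclic v (PathVia⇒Path cycle))

  -- The transitive closure of an acyclic relation, as a Boolean relation.
  closure : Edges n → Edges n
  closure X = warshall X (allFin n)

  closure-sound : ∀ {X a b} → T (closure X a b) → Path X a b
  closure-sound {X} = warshall-sound X (allFin n)

  closure-complete : ∀ {X} → Acyclic X → ∀ {a b} → Path X a b → T (closure X a b)
  closure-complete acyclic p = warshall-complete acyclic (allFin n) (Path⇒PathVia p)

  -- Interleaving a strict order R with a strict order C on the R-incomparable
  -- pairs.  If C covers every R-incomparable pair and C-chains of
  -- R-incomparable pairs stay R-incomparable, the result is a linear order,
  -- and the interleavings with C and with C⁻¹ meet in R; so R is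
  -- 2-dimensional.

  record Complementary (R C : Edges n) : Set where
    field
      R-transitive : Transitive R
      R-oriented   : Oriented R
      C-transitive : Transitive C
      C-oriented   : Oriented C
      C-covers     : ∀ a b → a ≢ b → ¬ T (𝒰 R a b) → T (C a b) ⊎ T (C b a)
      C-chains     : ∀ {a b c} → T (C a b) → T (C b c) →
                     ¬ T (𝒰 R a b) → ¬ T (𝒰 R b c) → ¬ T (𝒰 R a c)

  Complementary-inv : ∀ {R C : Edges n} → Complementary R C → Complementary R (inv C)
  Complementary-inv {R} h = record
    { R-transitive = R-transitive
    ; R-oriented   = R-oriented
    ; C-transitive = λ a b c ba cb a≢c → C-transitive c b a cb ba (λ c≡a → a≢c (sym c≡a))
    ; C-oriented   = λ a b ba ab → C-oriented a b ab ba
    ; C-covers     = λ a b a≢b ¬ab → swap (C-covers a b a≢b ¬ab)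
    ; C-chains     = λ ba cb ¬ab ¬bc ac →
        C-chains cb ba (¬𝒰-sym {R} ¬bc) (¬𝒰-sym {R} ¬ab) (𝒰-undirected R _ _ ac)
    }
    where open Complementary h

  interleave : Edges n → Edges n → Edges n
  interleave R C = R ∪ (C ∩ incomparable R)

  interleave-inl : ∀ {R C : Edges n} {a b} → T (R a b) → T (interleave R C a b)
  interleave-inl {R} {C} = ∪-inl {R} {C ∩ incomparable R}

  interleave-inr : ∀ {R C : Edges n} {a b} → T (C a b) → ¬ T (𝒰 R a b) → T (interleave R C a b)
  interleave-inr {R} {C} ab ¬ab =
    ∪-inr {R} {C ∩ incomparable R} (∩-intro {C} {incomparable R} ab (T-not ¬ab))

  interleave-elim : ∀ {R C : Edges n} {a b} → T (interleave R C a b) →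
                    T (R a b) ⊎ (T (C a b) × ¬ T (𝒰 R a b))
  interleave-elim {R} {C} l with ∪-elim {R} {C ∩ incomparable R} l
  ... | inj₁ ab = inj₁ ab
  ... | inj₂ c with ∩-elim {C} {incomparable R} c
  ...   | ab , inc = inj₂ (ab , T-not⁻¹ inc)

  module Interleave {R C : Edges n} (h : Complementary R C) where
    open Complementary h

    via-R : ∀ {a b} → T (R a b) → T (interleave R C a b)
    via-R = interleave-inl {R} {C}

    via-C : ∀ {a b} → T (C a b) → ¬ T (𝒰 R a b) → T (interleave R C a b)
    via-C = interleave-inr {R} {C}

    elim : ∀ {a b} → T (interleave R C a b) → T (R a b) ⊎ (T (C a b) × ¬ T (𝒰 R a b))
    elim = interleave-elim {R} {C}

    R-then-C : ∀ {a b c} → a ≢ c → T (R a b) → T (C b c) → ¬ T (𝒰 R b c) →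
               T (interleave R C a c)
    R-then-C {a} {b} {c} a≢c ab bc ¬bc with T? (𝒰 R a c)
    ... | yes u with 𝒰-elim {R} u
    ...   | inj₁ ac = via-R ac
    ...   | inj₂ ca = ⊥-elim (¬bc (𝒰-inr {R} (strict-trans R-transitive R-oriented ca ab)))
    R-then-C {a} {b} {c} a≢c ab bc ¬bc | no ¬ac with C-covers a c a≢c ¬ac
    ...   | inj₁ ac = via-C ac ¬ac
    ...   | inj₂ ca = ⊥-elim (C-chains bc ca ¬bc (¬𝒰-sym {R} ¬ac) (𝒰-inr {R} ab))

    C-then-R : ∀ {a b c} → a ≢ c → T (C a b) → ¬ T (𝒰 R a b) → T (R b c) →
               T (interleave R C a c)
    C-then-R {a} {b} {c} a≢c ab ¬ab bc with T? (𝒰 R a c)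
    ... | yes u with 𝒰-elim {R} u
    ...   | inj₁ ac = via-R ac
    ...   | inj₂ ca = ⊥-elim (¬ab (𝒰-inr {R} (strict-trans R-transitive R-oriented bc ca)))
    C-then-R {a} {b} {c} a≢c ab ¬ab bc | no ¬ac with C-covers a c a≢c ¬ac
    ...   | inj₁ ac = via-C ac ¬ac
    ...   | inj₂ ca = ⊥-elim (C-chains ca ab (¬𝒰-sym {R} ¬ac) ¬ab (𝒰-inr {R} bc))

    interleave-transitive : Transitive (interleave R C)
    interleave-transitive a b c l₁ l₂ a≢c with elim l₁ | elim l₂
    ... | inj₁ ab | inj₁ bc = via-R (R-transitive a b c ab bc a≢c)
    ... | inj₁ ab | inj₂ (bc , ¬bc) = R-then-C a≢c ab bc ¬bc
    ... | inj₂ (ab , ¬ab) | inj₁ bc = C-then-R a≢c ab ¬ab bc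
    ... | inj₂ (ab , ¬ab) | inj₂ (bc , ¬bc) = via-C (C-transitive a b c ab bc a≢c) (C-chains ab bc ¬ab ¬bc)

    interleave-oriented : Oriented (interleave R C)
    interleave-oriented a b l₁ l₂ with elim l₁ | elim l₂
    ... | inj₁ ab | inj₁ ba = R-oriented a b ab ba
    ... | inj₁ ab | inj₂ (_ , ¬ba) = ¬ba (𝒰-inr {R} ab)
    ... | inj₂ (_ , ¬ab) | inj₁ ba = ¬ab (𝒰-inr {R} ba)
    ... | inj₂ (ab , _) | inj₂ (ba , _) = C-oriented a b ab ba

    interleave-total : ∀ a b → a ≢ b → T (interleave R C a b) ⊎ T (interleave R C b a)
    interleave-total a b a≢b with T? (𝒰 R a b)
    ... | yes u with 𝒰-elim {R} u
    ...   | inj₁ ab = inj₁ (via-R ab)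
    ...   | inj₂ ba = inj₂ (via-R ba)
    interleave-total a b a≢b | no ¬ab with C-covers a b a≢b ¬ab
    ...   | inj₁ ab = inj₁ (via-C ab ¬ab)
    ...   | inj₂ ba = inj₂ (via-C ba (¬𝒰-sym {R} ¬ab))

    interleave-linear : StrictLinearOrder (interleave R C)
    interleave-linear = oriented⇒simple interleave-oriented , interleave-transitive ,
                        interleave-total , interleave-oriented

  interleave-meet : ∀ {R C : Edges n} → Oriented C → ∀ a b →
    T (interleave R C a b) → T (interleave R (inv C) a b) → T (R a b)
  interleave-meet {R} {C} C-oriented a b l₁ l₂
    with interleave-elim {R} {C} l₁ | interleave-elim {R} {inv C} l₂
  ... | inj₁ ab | _ = ab
  ... | inj₂ _ | inj₁ ab = ab
  ... | inj₂ (ab , _) | inj₂ (ba , _) = ⊥-elim (C-oriented a b ab ba)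

  complementary⇒twoDimensional : ∀ {R C : Edges n} → Complementary R C → TwoDimensional R
  complementary⇒twoDimensional {R} {C} h =
    interleave R C , interleave R (inv C) ,
    Interleave.interleave-linear h , Interleave.interleave-linear (Complementary-inv h) ,
    λ a b → (λ ab → Interleave.via-R h ab , Interleave.via-R (Complementary-inv h) ab) ,
            λ (l₁ , l₂) → interleave-meet {R} {C} (Complementary.C-oriented h) a b l₁ l₂

  record CoOrientation (X C : Edges n) : Set where
    field
      transitive : Transitive C
      oriented   : Oriented C
      avoids     : ∀ {a b} → T (C a b) → ¬ T (𝒰 X a b)
      covers     : ∀ a b → a ≢ b → ¬ T (𝒰 X a b) → T (C a b) ⊎ T (C b a)

  CoOrientation-inv : ∀ {X C : Edges n} → CoOrientation X C → CoOrientation X (inv C)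
  CoOrientation-inv {X} co = record
    { transitive = λ a b c ba cb a≢c → transitive c b a cb ba (λ c≡a → a≢c (sym c≡a))
    ; oriented   = λ a b ba ab → oriented a b ab ba
    ; avoids     = λ ba u → avoids ba (𝒰-undirected X _ _ u)
    ; covers     = λ a b a≢b ¬ab → swap (covers a b a≢b ¬ab)
    }
    where open CoOrientation co

  -- The key step: if C v y and C y z, where neither v nor z is joined to y
  -- by an X-path, then there is no X-path from v to z.  Walk along such a
  -- path keeping the invariant (C w y, no X-path from w to y) at its
  -- current vertex w: the next vertex is not adjacent to y in 𝒰 X, so C
  -- orders it against y, and only C-below y is consistent; at the end
  -- C v z would contradict the X-edge into z.
  no-path-across : ∀ {X C : Edges n} → CoOrientation X C → ∀ {v y z} →
    T (C y z) → ¬ Path X y z → T (C v y) → ¬ Path X v y → ¬ Path X v z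
  no-path-across {X} co yz ¬y⇝z vy ¬v⇝y (edge vz) =
    avoids (strict-trans transitive oriented vy yz) (𝒰-inl {X} vz)
    where open CoOrientation co
  no-path-across {X} co {y = y} yz ¬y⇝z vy ¬v⇝y (_∷ₚ_ {b = w} vw w⇝z) with w ≟ y
  ... | yes refl = ¬v⇝y (edge vw)
  ... | no w≢y with T? (𝒰 X w y)
  ...   | yes u with 𝒰-elim {X} u
  ...     | inj₁ wy = ¬v⇝y (vw ∷ₚ edge wy)
  ...     | inj₂ yw = ¬y⇝z (yw ∷ₚ w⇝z)
  no-path-across {X} co {y = y} yz ¬y⇝z vy ¬v⇝y (_∷ₚ_ {b = w} vw w⇝z)
      | no w≢y | no ¬wy with CoOrientation.covers co w y w≢y ¬wy
  ...   | inj₁ wy = no-path-across co yz ¬y⇝z wy (λ w⇝y → ¬v⇝y (vw ∷ₚ w⇝y)) w⇝z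
  ...   | inj₂ yw = avoids (strict-trans transitive oriented vy yw) (𝒰-inl {X} vw)
    where open CoOrientation co

  closure-complementary : ∀ {X C : Edges n} → Acyclic X → CoOrientation X C →
                          Complementary (closure X) C
  closure-complementary {X} {C} acyclic co = record
    { R-transitive = λ a b c ab bc _ → closure-complete acyclic (closure-sound ab ++ₚ closure-sound bc)
    ; R-oriented   = λ a b ab ba → acyclic a (closure-sound ab ++ₚ closure-sound ba)
    ; C-transitive = transitive
    ; C-oriented   = oriented
    ; C-covers     = λ a b a≢b ¬ab → covers a b a≢b (λ u → ¬ab (𝒰-mono X⊆closure a b u))
    ; C-chains     = chains
    }
    where
    open CoOrientation co
    X⊆closure : X ⊆E closure X
    X⊆closure a b e = closure-complete acyclic (edge e)
    no-path : ∀ {a b} → ¬ T (𝒰 (closure X) a b) → ¬ Path X a b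
    no-path ¬ab p = ¬ab (𝒰-inl {closure X} (closure-complete acyclic p))
    no-path⁻¹ : ∀ {a b} → ¬ T (𝒰 (closure X) a b) → ¬ Path X b a
    no-path⁻¹ ¬ab p = ¬ab (𝒰-inr {closure X} (closure-complete acyclic p))
    chains : ∀ {a b c} → T (C a b) → T (C b c) →
             ¬ T (𝒰 (closure X) a b) → ¬ T (𝒰 (closure X) b c) → ¬ T (𝒰 (closure X) a c)
    chains ab bc ¬ab ¬bc u with 𝒰-elim {closure X} u
    ... | inj₁ ac = no-path-across co bc (no-path ¬bc) ab (no-path ¬ab) (closure-sound ac)
    ... | inj₂ ca = no-path-across (CoOrientation-inv co) ab (no-path⁻¹ ¬ab) bc (no-path⁻¹ ¬bc)
                                   (closure-sound ca)

  -- (A) If S is the intersection of the linear orders L₁ and L₂, then S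
  -- transitively orients 𝒰 S and L₁ ∩ L₂⁻¹ transitively orients its
  -- complement, so 𝒰 S is a permutation graph.
  module Realiser {S L₁ L₂ : Edges n}
    (transitive₁ : Transitive L₁) (total₁ : ∀ a b → a ≢ b → T (L₁ a b) ⊎ T (L₁ b a))
    (oriented₁ : Oriented L₁)
    (transitive₂ : Transitive L₂) (total₂ : ∀ a b → a ≢ b → T (L₂ a b) ⊎ T (L₂ b a))
    (oriented₂ : Oriented L₂)
    (realises : ∀ a b → (T (S a b) → T (L₁ a b) × T (L₂ a b)) ×
                        (T (L₁ a b) × T (L₂ a b) → T (S a b))) where

    S⇒L : ∀ {a b} → T (S a b) → T (L₁ a b) × T (L₂ a b)
    S⇒L {a} {b} = proj₁ (realises a b)

    L⇒S : ∀ {a b} → T (L₁ a b) → T (L₂ a b) → T (S a b)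
    L⇒S {a} {b} ab₁ ab₂ = proj₂ (realises a b) (ab₁ , ab₂)

    S-transitive : Transitive S
    S-transitive a b c ab bc a≢c =
      L⇒S (transitive₁ a b c (proj₁ (S⇒L ab)) (proj₁ (S⇒L bc)) a≢c)
          (transitive₂ a b c (proj₂ (S⇒L ab)) (proj₂ (S⇒L bc)) a≢c)

    S-oriented : Oriented S
    S-oriented a b ab ba = oriented₁ a b (proj₁ (S⇒L ab)) (proj₁ (S⇒L ba))

    crossing : Edges n
    crossing = L₁ ∩ inv L₂

    crossing-transitive : Transitive crossing
    crossing-transitive a b c ab bc a≢c with ∩-elim {L₁} {inv L₂} ab | ∩-elim {L₁} {inv L₂} bc
    ... | ab₁ , ba₂ | bc₁ , cb₂ =
      ∩-intro {L₁} {inv L₂} (transitive₁ a b c ab₁ bc₁ a≢c)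
                            (transitive₂ c b a cb₂ ba₂ (λ c≡a → a≢c (sym c≡a)))

    crossing-oriented : Oriented crossing
    crossing-oriented a b ab ba =
      oriented₁ a b (proj₁ (∩-elim {L₁} {inv L₂} ab)) (proj₁ (∩-elim {L₁} {inv L₂} ba))

    crossing⊆complement : crossing ⊆E complement (𝒰 S)
    crossing⊆complement a b ab with ∩-elim {L₁} {inv L₂} ab
    ... | ab₁ , ba₂ = complement-intro {𝒰 S} a≢b not-comparable
      where
      a≢b : a ≢ b
      a≢b refl = oriented₁ a a ab₁ ab₁
      not-comparable : ¬ T (𝒰 (𝒰 S) a b)
      not-comparable u with 𝒰-elim {S} (undirected-𝒰 (𝒰-undirected S) a b u)
      ... | inj₁ s = oriented₂ b a ba₂ (proj₂ (S⇒L s))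
      ... | inj₂ s = oriented₁ a b ab₁ (proj₁ (S⇒L s))

    crossing-covers : ∀ a b → T (complement (𝒰 S) a b) → T (crossing a b) ⊎ T (crossing b a)
    crossing-covers a b c with complement-elim {𝒰 S} c
    ... | a≢b , ¬ab with total₁ a b a≢b | total₂ a b a≢b
    ...   | inj₁ ab₁ | inj₁ ab₂ = ⊥-elim (¬ab (𝒰-inl {𝒰 S} (𝒰-inl {S} (L⇒S ab₁ ab₂))))
    ...   | inj₁ ab₁ | inj₂ ba₂ = inj₁ (∩-intro {L₁} {inv L₂} ab₁ ba₂)
    ...   | inj₂ ba₁ | inj₁ ab₂ = inj₂ (∩-intro {L₁} {inv L₂} ba₁ ab₂)
    ...   | inj₂ ba₁ | inj₂ ba₂ = ⊥-elim (¬ab (𝒰-inl {𝒰 S} (𝒰-inr {S} (L⇒S ba₁ ba₂))))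

    permutation : PermutationGraph (𝒰 S)
    permutation =
      𝒰-simple {S} (oriented⇒simple S-oriented) , 𝒰-undirected S ,
      (S , covering⇒orientation (λ a b → 𝒰-inl {S}) S-oriented (λ a b → 𝒰-elim {S}) , S-transitive) ,
      (crossing , covering⇒orientation crossing⊆complement crossing-oriented crossing-covers ,
       crossing-transitive)

  twoDimensional⇒permutation : ∀ {S : Edges n} → TwoDimensional S → PermutationGraph (𝒰 S)
  twoDimensional⇒permutation
    (L₁ , L₂ , (_ , transitive₁ , total₁ , oriented₁) , (_ , transitive₂ , total₂ , oriented₂) , realises) =
    Realiser.permutation transitive₁ total₁ oriented₁ transitive₂ total₂ oriented₂ realises

  -- (B) A permutation graph P ⊆ 𝒰 G, with G acyclic and transitive, lies in
  -- the undirected closure of a 2-dimensional subgraph of G: the transitive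
  -- closure of the orientation P ∩ G of P.
  module PermutationInside {G P : Edges n} (acyclic : Acyclic G) (transitive : Transitive G)
    (P⊆𝒰G : P ⊆E 𝒰 G) (undirected : Undirected P) where

    X : Edges n
    X = P ∩ G

    X⊆G : X ⊆E G
    X⊆G a b x = proj₂ (∩-elim {P} {G} x)

    X-acyclic : Acyclic X
    X-acyclic a cycle = acyclic a (Path-mono X⊆G cycle)

    P⊆𝒰X : P ⊆E 𝒰 X
    P⊆𝒰X a b p with 𝒰-elim {G} (P⊆𝒰G a b p)
    ... | inj₁ ab = 𝒰-inl {X} (∩-intro {P} {G} p ab)
    ... | inj₂ ba = 𝒰-inr {X} (∩-intro {P} {G} (undirected a b p) ba)

    𝒰X⊆P : 𝒰 X ⊆E P
    𝒰X⊆P = ⊆-trans (𝒰-mono (λ a b x → proj₁ (∩-elim {P} {G} x))) (undirected-𝒰 undirected)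

    coOrientation : ∀ {C} → IsOrientation C (complement P) → Transitive C → CoOrientation X C
    coOrientation {C} orientation@(C⊆complement , C-oriented , _) C-transitive = record
      { transitive = C-transitive
      ; oriented   = C-oriented
      ; avoids     = λ {a} {b} ab u →
          proj₂ (complement-elim {P} (C⊆complement a b ab)) (𝒰-inl {P} (𝒰X⊆P a b u))
      ; covers     = λ a b a≢b ¬ab → orientation-covers (complement-simple P) orientation a b
          (complement-intro {P} a≢b (λ u → ¬ab (P⊆𝒰X a b (undirected-𝒰 undirected a b u))))
      }

    S : Edges n
    S = closure X

    S⊆G : S ⊆E G
    S⊆G a b s = transitive-closed acyclic transitive (Path-mono X⊆G (closure-sound s))

    P⊆𝒰S : P ⊆E 𝒰 S
    P⊆𝒰S = ⊆-trans P⊆𝒰X (𝒰-mono (λ a b x → closure-complete X-acyclic (edge x)))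

  permutation⇒twoDimensional : ∀ {G P : Edges n} → Acyclic G → Transitive G → P ⊆E 𝒰 G →
    PermutationGraph P → ∃[ S ] (S ⊆E G × TwoDimensional S × P ⊆E 𝒰 S)
  permutation⇒twoDimensional acyclic transitive P⊆𝒰G
    (_ , undirected , _ , (C , orientation , C-transitive)) =
    S , S⊆G ,
    complementary⇒twoDimensional
      (closure-complementary X-acyclic (coOrientation orientation C-transitive)) ,
    P⊆𝒰S
    where open PermutationInside acyclic transitive P⊆𝒰G undirected

  𝒰-reflects : ∀ {G R R' : Edges n} → Acyclic G → R ⊆E G → R' ⊆E G → 𝒰 R ⊆E 𝒰 R' → R ⊆E R'
  𝒰-reflects {R = R} {R'} acyclic R⊆G R'⊆G 𝒰R⊆𝒰R' a b r
    with 𝒰-elim {R'} (𝒰R⊆𝒰R' a b (𝒰-inl {R} r))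
  ... | inj₁ ab = ab
  ... | inj₂ ba = ⊥-elim (acyclic a (R⊆G a b r ∷ₚ edge (R'⊆G b a ba)))

  twoDimensional-resp : ∀ {S S' : Edges n} → S ⊆E S' → S' ⊆E S → TwoDimensional S → TwoDimensional S'
  twoDimensional-resp S⊆S' S'⊆S (L₁ , L₂ , linear₁ , linear₂ , realises) =
    L₁ , L₂ , linear₁ , linear₂ , λ a b →
      (λ s' → proj₁ (realises a b) (S'⊆S a b s')) , (λ l → S⊆S' a b (proj₂ (realises a b) l))

-- The theorem.
lemma13 : (n : ℕ) (G S : Edges n) →
    Simple G → Acyclic G → Transitive G → S ⊆E G →
    (MaxTwoDimSubgraph S G → MaxPermSubgraph (𝒰 S) (𝒰 G)) ×
    (MaxPermSubgraph (𝒰 S) (𝒰 G) → MaxTwoDimSubgraph S G)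
lemma13 n G S _ acyclic transitive S⊆G = twoDim⇒perm , perm⇒twoDim
  where
  twoDim⇒perm : MaxTwoDimSubgraph S G → MaxPermSubgraph (𝒰 S) (𝒰 G)
  twoDim⇒perm ((_ , S-twoDim) , S-maximal) =
    (𝒰-mono S⊆G , twoDimensional⇒permutation S-twoDim) , maximal
    where
    -- P' lies in 𝒰 S' for a 2-dimensional S' ⊆ G, which contains S, hence equals S
    maximal : ∀ P' → P' ⊆E 𝒰 G → PermutationGraph P' → 𝒰 S ⊆E P' → P' ⊆E 𝒰 S
    maximal P' P'⊆𝒰G P'-perm 𝒰S⊆P'
      with permutation⇒twoDimensional acyclic transitive P'⊆𝒰G P'-perm
    ... | S' , S'⊆G , S'-twoDim , P'⊆𝒰S' =
      ⊆-trans P'⊆𝒰S' (𝒰-mono (S-maximal S' S'⊆G S'-twoDim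
                                (𝒰-reflects acyclic S⊆G S'⊆G (⊆-trans 𝒰S⊆P' P'⊆𝒰S'))))

  perm⇒twoDim : MaxPermSubgraph (𝒰 S) (𝒰 G) → MaxTwoDimSubgraph S G
  perm⇒twoDim ((𝒰S⊆𝒰G , 𝒰S-perm) , 𝒰S-maximal)
    with permutation⇒twoDimensional acyclic transitive 𝒰S⊆𝒰G 𝒰S-perm
  ... | S' , S'⊆G , S'-twoDim , 𝒰S⊆𝒰S' = (S⊆G , S-twoDim) , maximal
    where
    -- by maximality of 𝒰 S, a 2-dimensional subgraph of G whose undirected
    -- closure contains 𝒰 S is contained in S
    enlarges : ∀ {S''} → S'' ⊆E G → TwoDimensional S'' → 𝒰 S ⊆E 𝒰 S'' → S'' ⊆E S
    enlarges {S''} S''⊆G S''-twoDim 𝒰S⊆𝒰S'' = 𝒰-reflects acyclic S''⊆G S⊆G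
      (𝒰S-maximal (𝒰 S'') (𝒰-mono S''⊆G) (twoDimensional⇒permutation S''-twoDim) 𝒰S⊆𝒰S'')
    -- the 2-dimensional S' has the same edges as S
    S-twoDim : TwoDimensional S
    S-twoDim = twoDimensional-resp (enlarges S'⊆G S'-twoDim 𝒰S⊆𝒰S')
                 (𝒰-reflects acyclic S⊆G S'⊆G 𝒰S⊆𝒰S') S'-twoDim
    maximal : ∀ S'' → S'' ⊆E G → TwoDimensional S'' → S ⊆E S'' → S'' ⊆E S
    maximal S'' S''⊆G S''-twoDim S⊆S'' = enlarges S''⊆G S''-twoDim (𝒰-mono S⊆S'')
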